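{- Let $\mathbb{S}$ and $\mathbb{T}$ be algebraic theories such that: (S1) for all $\mathbb S$-terms $s',s''$: if $\emptyset \vdash s'$ and $\Gamma\vdash s' =_{\mathbb{S}} s''$ then $\emptyset\vdash s''$; (S2) for every $\mathbb S$-term $s'$ and variable $x$: if $\Gamma\vdash s' =_{\mathbb{S}} x$ then $\{x\}\vdash s'$; (S4) for every $\mathbb{S}$-term $s'$ with at least one variable there is a substitution $f$ from $\mathrm{var}(s')$ to $\mathbb{S}$-terms such that for every $x\in\mathrm{var}(s')$, $s'[f(y)/y\neq x] =_{\mathbb{S}} x$; (T2) for all $\mathbb T$-terms $t',t''$: if $\emptyset \vdash t'$ and $\Gamma\vdash t' =_{\mathbb{T}} t''$ then $\emptyset\vdash t''$; (T3) for every $\mathbb T$-term $t'$ and variable $x$: if $\Gamma\vdash t' =_{\mathbb{T}} x$ then $\{x\}\vdash t'$; (T4) $\mathbb{T}$ has a constant $e_{\mathbb{T}}$. Suppose there are terms $2\vdash_{\mathbb{S}} s$ and $2\vdash_{\mathbb{T}} t$ and constants $e_s$ of $\mathbb{S}$ and $e_t$ of $\mathbb{T}$ with $s(x,e_s) =_{\mathbb{S}} x =_{\mathbb{S}} s(e_s,x)$ and $t(x,e_t) =_{\mathbb{T}} x =_{\mathbb{T}} t(e_t,x)$. Let $\mathbb{U}$ be a composite theory of $\mathbb{T}$ after $\mathbb{S}$. Then $s(t(y_1,y_2),x_0) =_{\mathbb{U}} t(s(y_1,x_0),s(y_2,x_0))$ and $s(x_0,t(y_1,y_2)) =_{\mathbb{U}}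 t(s(x_0,y_1),s(x_0,y_2))$.
   Context: An algebraic theory consists of a signature and equations; $=_{\mathbb T}$ is provable equality. $\mathrm{var}(t)$ is the set of variables of $t$; $Y\vdash t$ means $\mathrm{var}(t)\subseteq Y$; $\Gamma$ is an arbitrary context; a constant is a $0$-ary operation. $s'[f(y)/y\neq x]$ substitutes $f(y)$ for every variable $y\neq x$ of $s'$. For theories $\mathbb{S},\mathbb{T}$: $\mathbb{U}$ contains them if its signature contains both signatures and their equations are provable in $\mathbb{U}$; a separated term is $t[s_x/x]$ (simultaneous substitution) with $t$ a $\mathbb{T}$-term with variables in $X$ and $s_x$ $\mathbb{S}$-terms; separated terms $t[s_x/x]$, $t'[s'_{x'}/x']$ are equal modulo $(\mathbb{T},\mathbb{S})$ if there are $f:X\to Y$, $f':X'\to Y$ and $\mathbb{S}$-terms $\bar s_y$ with $t[f(x)/x]=_{\mathbb T}t'[f'(x')/x']$, $s_x=_{\mathbb S}\bar s_{f(x)}$, $s'_{x'}=_{\mathbb S}\bar s_{f'(x')}$; $\mathbb{U}$ is a composite theory of $\mathbb{T}$ after $\mathbb{S}$ if every $\mathbb U$-term is $\mathbb U$-equal to a separated term and any two separated terms $\mathbb U$-equal to a common term are equal modulo $(\mathbb{T},\mathbb{S})$. -}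

module Defs where

open import Data.Nat using (ℕ; zero; suc; _≟_)
open import Data.Fin using (Fin)
open import Data.Product using (Σ; ∃; _×_; _,_)
open import Data.Empty using (⊥)
open import Data.Sum using (_⊎_)
open import Relation.Nullary using (¬_; yes; no)
open import Relation.Binary.PropositionalEquality using (_≡_)
import Relation.Binary.PropositionalEquality as Eq

record Signature : Set₁ where
  field
    Op : Set
    ar : Op → ℕ
open Signature public

data Term (Sg : Signature) : Set where
  var : ℕ → Term Sg
  op  : (o : Op Sg) → (Fin (ar Sg o) → Term Sg) → Term Sg

Subst : Signature → Set
Subst Sg = ℕ → Term Sg

_⟪_⟫ : ∀ {Sg} → Term Sg → Subst Sg → Term Sg
var x  ⟪ σ ⟫ = σ x
op o f ⟪ σ ⟫ = op o (λ i → f i ⟪ σ ⟫)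

rename : ∀ {Sg} → (ℕ → ℕ) → Term Sg → Term Sg
rename f t = t ⟪ (λ x → var (f x)) ⟫

data _∈var_ {Sg : Signature} (x : ℕ) : Term Sg → Set where
  here  : x ∈var var x
  there : ∀ {o f} (i : Fin (ar Sg o)) → x ∈var f i → x ∈var op o f

Closed : ∀ {Sg} → Term Sg → Set
Closed t = ∀ y → ¬ (y ∈var t)

OnlyVar : ∀ {Sg} → ℕ → Term Sg → Set
OnlyVar x t = ∀ y → y ∈var t → y ≡ x

Binary : ∀ {Sg} → Term Sg → Set
Binary t = ∀ y → y ∈var t → (y ≡ 0) ⊎ (y ≡ 1)

[_,_] : ∀ {Sg} → Term Sg → Term Sg → Subst Sg
[ a , b ] zero          = a
[ a , b ] (suc zero)    = b
[ a , b ] (suc (suc n)) = var (suc (suc n))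

app2 : ∀ {Sg} → Term Sg → Term Sg → Term Sg → Term Sg
app2 s a b = s ⟪ [ a , b ] ⟫

substExcept : ∀ {Sg} → Term Sg → Subst Sg → ℕ → Term Sg
substExcept s f x = s ⟪ (λ y → g y (y ≟ x)) ⟫
  where
  g : (y : ℕ) → _ → Term _
  g y (yes _) = var y
  g y (no _)  = f y

constTerm : ∀ {Sg} (c : Op Sg) → ar Sg c ≡ 0 → Term Sg
constTerm {Sg} c p = op c (λ i → absurd (Eq.subst Fin p i))
  where
  absurd : Fin 0 → Term Sg
  absurd ()

record Theory : Set₁ where
  field
    sig : Signature
    Ax  : Set
    lhs : Ax → Term sig
    rhs : Ax → Term sig
open Theory public

TermOf : Theory → Set
TermOf 𝕋 = Term (sig 𝕋)

infix 3 _⊢_≈_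
data _⊢_≈_ (𝕋 : Theory) : TermOf 𝕋 → TermOf 𝕋 → Set where
  ax    : (a : Ax 𝕋) (σ : Subst (sig 𝕋)) → 𝕋 ⊢ lhs 𝕋 a ⟪ σ ⟫ ≈ rhs 𝕋 a ⟪ σ ⟫
  refl  : ∀ {u} → 𝕋 ⊢ u ≈ u
  sym   : ∀ {u v} → 𝕋 ⊢ u ≈ v → 𝕋 ⊢ v ≈ u
  trans : ∀ {u v w} → 𝕋 ⊢ u ≈ v → 𝕋 ⊢ v ≈ w → 𝕋 ⊢ u ≈ w
  cong  : ∀ (o : Op (sig 𝕋)) {f g} → (∀ i → 𝕋 ⊢ f i ≈ g i) → 𝕋 ⊢ op o f ≈ op o g

ClosedStable : Theory → Set
ClosedStable 𝕋 = ∀ (t' t'' : TermOf 𝕋) → Closed t' → 𝕋 ⊢ t' ≈ t'' → Closed t''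

VarStable : Theory → Set
VarStable 𝕋 = ∀ (t' : TermOf 𝕋) (x : ℕ) → 𝕋 ⊢ t' ≈ var x → OnlyVar x t'

CancelVars : Theory → Set
CancelVars 𝕋 = ∀ (s' : TermOf 𝕋) → (∃ λ x → x ∈var s') →
  Σ (Subst (sig 𝕋)) λ f → ∀ x → x ∈var s' → 𝕋 ⊢ substExcept s' f x ≈ var x

HasConstant : Theory → Set
HasConstant 𝕋 = Σ (Op (sig 𝕋)) λ c → ar (sig 𝕋) c ≡ 0

record SigMor (Sg Sg' : Signature) : Set where
  field
    ι    : Op Sg → Op Sg'
    ι-ar : ∀ o → ar Sg' (ι o) ≡ ar Sg o
open SigMor public

translate : ∀ {Sg Sg'} → SigMor Sg Sg' → Term Sg → Term Sg'
translate m (var x)  = var x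
translate m (op o f) = op (ι m o) (λ i → translate m (f (Eq.subst Fin (ι-ar m o) i)))

record Contains (𝕌 𝕋 : Theory) : Set where
  field
    incl        : SigMor (sig 𝕋) (sig 𝕌)
    ax-provable : ∀ (a : Ax 𝕋) → 𝕌 ⊢ translate incl (lhs 𝕋 a) ≈ translate incl (rhs 𝕋 a)

tr : ∀ {𝕌 𝕋} → Contains 𝕌 𝕋 → TermOf 𝕋 → TermOf 𝕌
tr c = translate (Contains.incl c)
open Contains public

-- Separated terms t[s_x/x]: a 𝕋-term t (X = var t) and 𝕊-terms s_x

record Separated (𝕋 𝕊 : Theory) : Set where
  constructor sep
  field
    top : TermOf 𝕋
    bot : ℕ → TermOf 𝕊
open Separated public

⟦_⟧sep : ∀ {𝕌 𝕋 𝕊} → Separated 𝕋 𝕊 → Contains 𝕌 𝕋 → Contains 𝕌 𝕊 → TermOf 𝕌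
⟦ sep t s ⟧sep cT cS = tr cT t ⟪ (λ x → tr cS (s x)) ⟫

EqualModulo : (𝕋 𝕊 : Theory) → Separated 𝕋 𝕊 → Separated 𝕋 𝕊 → Set
EqualModulo 𝕋 𝕊 (sep t s) (sep t' s') =
  Σ (ℕ → ℕ) λ f → Σ (ℕ → ℕ) λ f' → Σ (ℕ → TermOf 𝕊) λ s̄ →
    (𝕋 ⊢ rename f t ≈ rename f' t') ×
    (∀ x → x ∈var t → 𝕊 ⊢ s x ≈ s̄ (f x)) ×
    (∀ x' → x' ∈var t' → 𝕊 ⊢ s' x' ≈ s̄ (f' x'))

record Composite (𝕌 𝕋 𝕊 : Theory) (cT : Contains 𝕌 𝕋) (cS : Contains 𝕌 𝕊) : Set where
  field
    separation : ∀ (u : TermOf 𝕌) →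
      Σ (Separated 𝕋 𝕊) λ p → 𝕌 ⊢ u ≈ ⟦ p ⟧sep cT cS
    uniqueness : ∀ (p q : Separated 𝕋 𝕊) (u : TermOf 𝕌) →
      𝕌 ⊢ ⟦ p ⟧sep cT cS ≈ u → 𝕌 ⊢ ⟦ q ⟧sep cT cS ≈ u → EqualModulo 𝕋 𝕊 p q

-- Separate u = s(t(y₁,y₂),x₀) as t'[σ_z/z]. Killing x₀ with the unit of s turns u
-- into t(y₁,y₂), so uniqueness of separated terms identifies t' with t up to
-- renaming, each variable z of t' going to y₁ or y₂, with σ_z[eₛ/x₀] = y₁ or y₂
-- accordingly; by (S2) σ_z then avoids the other variable y_j. Killing y_j with the
-- unit of t turns u into the 𝕊-term s(y_i,x₀) while leaving σ_z untouched, and a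
-- second appeal to uniqueness (after flattening the resulting nested separated
-- terms) forces σ_z = s(y_i,x₀). Hence u = t(s(y₁,x₀),s(y₂,x₀)); the left law is
-- the right law for the flipped term s(y,x).

module Submission where

open import Defs
open import Level using (0ℓ)
open import Data.Nat using (ℕ; zero; suc; _+_; _≟_)
open import Data.Nat.Properties using (+-suc; +-identityʳ; suc-injective)
open import Data.Fin using (Fin)
open import Data.Fin.Properties using (any?)
open import Data.Product using (∃; _×_; _,_; proj₁; proj₂; uncurry)
open import Data.Sum using (_⊎_; inj₁; inj₂)
open import Data.Empty using (⊥-elim)
open import Function using (_∘_)
open import Relation.Nullary using (yes; no; Dec)
open import Relation.Binary.Bundles using (Setoid)
import Relation.Binary.Reasoning.Setoid as SetoidReasoning
import Relation.Binary.PropositionalEquality as P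
open P using (_≡_; _≢_)

-- Cantor's enumeration of ℕ × ℕ along the anti-diagonals a + b = d; the
-- diagonal d is passed as fuel so that pairOn is structurally recursive.

next : ℕ × ℕ → ℕ × ℕ
next (a , zero)  = zero , suc a
next (a , suc b) = suc a , b

unpair : ℕ → ℕ × ℕ
unpair zero    = zero , zero
unpair (suc n) = next (unpair n)

pairOn : ℕ → ℕ → ℕ → ℕ
pairOn d       zero    zero    = zero
pairOn d       (suc a) b       = suc (pairOn d a (suc b))
pairOn (suc d) zero    (suc b) = suc (pairOn d b zero)
pairOn zero    zero    (suc b) = zero

pair : ℕ → ℕ → ℕ
pair a b = pairOn (a + b) a b

unpair-pairOn : ∀ d a b → a + b ≡ d → unpair (pairOn d a b) ≡ (a , b)
unpair-pairOn d       zero    zero    _  = P.refl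
unpair-pairOn d       (suc a) b       eq = P.cong next (unpair-pairOn d a (suc b) (P.trans (+-suc a b) eq))
unpair-pairOn (suc d) zero    (suc b) eq =
  P.cong next (unpair-pairOn d b zero (P.trans (+-identityʳ b) (suc-injective eq)))
unpair-pairOn zero    zero    (suc b) ()

unpair-pair : ∀ a b → unpair (pair a b) ≡ (a , b)
unpair-pair a b = unpair-pairOn (a + b) a b P.refl

infix 9 _↦_

_↦_ : ∀ {Sg} → ℕ → Term Sg → Subst Sg
(j ↦ E) n with n ≟ j
... | yes _ = E
... | no  _ = var n

↦-same : ∀ {Sg} j (E : Term Sg) → (j ↦ E) j ≡ E
↦-same j E with j ≟ j
... | yes _   = P.refl
... | no  j≢j = ⊥-elim (j≢j P.refl)

↦-other : ∀ {Sg} {j n} (E : Term Sg) → n ≢ j → (j ↦ E) n ≡ var n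
↦-other {j = j} {n} E n≢j with n ≟ j
... | yes n≡j = ⊥-elim (n≢j n≡j)
... | no  _   = P.refl

module _ {Sg : Signature} where

  ∈var-⟪⟫ : ∀ {x y} (t : Term Sg) (σ : Subst Sg) → x ∈var t → y ∈var σ x → y ∈var (t ⟪ σ ⟫)
  ∈var-⟪⟫ (var x)  σ here         y∈ = y∈
  ∈var-⟪⟫ (op o f) σ (there i x∈) y∈ = there i (∈var-⟪⟫ (f i) σ x∈ y∈)

  ∈var-⟪⟫⁻ : ∀ {y} (t : Term Sg) (σ : Subst Sg) → y ∈var (t ⟪ σ ⟫) → ∃ λ x → x ∈var t × y ∈var σ x
  ∈var-⟪⟫⁻ (var x)  σ y∈          = x , here , y∈
  ∈var-⟪⟫⁻ (op o f) σ (there i y∈) with ∈var-⟪⟫⁻ (f i) σ y∈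
  ... | x , x∈ , y∈σx = x , there i x∈ , y∈σx

  ∈var-rename : ∀ {x} (f : ℕ → ℕ) (t : Term Sg) → x ∈var t → f x ∈var rename f t
  ∈var-rename f t x∈ = ∈var-⟪⟫ t _ x∈ here

  ∈var-rename⁻ : ∀ {y} (f : ℕ → ℕ) (t : Term Sg) → y ∈var rename f t → ∃ λ x → x ∈var t × y ≡ f x
  ∈var-rename⁻ f t y∈ with ∈var-⟪⟫⁻ t _ y∈
  ... | x , x∈ , here = x , x∈ , P.refl

  hasVar? : (t : Term Sg) → Dec (∃ (_∈var t))
  hasVar? (var x)  = yes (x , here)
  hasVar? (op o f) with any? (λ i → hasVar? (f i))
  ... | yes (i , x , x∈) = yes (x , there i x∈)
  ... | no  none         = no λ { (x , there i x∈) → none (i , x , x∈) }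

  constTerm-closed : ∀ (c : Op Sg) (c0 : ar Sg c ≡ 0) → Closed (constTerm {Sg} c c0)
  constTerm-closed c c0 y (there i _) with P.subst Fin c0 i
  ... | ()

  app2-binary : (w a b : Term Sg) → Binary w → Binary a → Binary b → Binary (app2 w a b)
  app2-binary w a b bw ba bb y y∈ with ∈var-⟪⟫⁻ w [ a , b ] y∈
  ... | x , x∈ , y∈ab with bw x x∈
  ... | inj₁ P.refl = ba y y∈ab
  ... | inj₂ P.refl = bb y y∈ab

∈var-translate : ∀ {Sg Sg'} (m : SigMor Sg Sg') {x} (a : Term Sg) → x ∈var translate m a → x ∈var a
∈var-translate m (var x)  here         = here
∈var-translate m (op o f) (there i x∈) = there _ (∈var-translate m (f _) x∈)

≈-setoid : Theory → Setoid 0ℓ 0ℓ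
≈-setoid 𝕋 = record
  { Carrier       = TermOf 𝕋
  ; _≈_           = 𝕋 ⊢_≈_
  ; isEquivalence = record { refl = refl ; sym = sym ; trans = trans }
  }

module ≈-Reasoning (𝕋 : Theory) = SetoidReasoning (≈-setoid 𝕋)

module _ {𝕋 : Theory} where

  ≡⇒≈ : ∀ {a b : TermOf 𝕋} → a ≡ b → 𝕋 ⊢ a ≈ b
  ≡⇒≈ P.refl = refl

  ⟪⟫-assoc : (t : TermOf 𝕋) (σ τ : Subst (sig 𝕋)) → 𝕋 ⊢ t ⟪ σ ⟫ ⟪ τ ⟫ ≈ t ⟪ (λ x → σ x ⟪ τ ⟫) ⟫
  ⟪⟫-assoc (var x)  σ τ = refl
  ⟪⟫-assoc (op o f) σ τ = cong o (λ i → ⟪⟫-assoc (f i) σ τ)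

  ⟪⟫-cong : (t : TermOf 𝕋) {σ τ : Subst (sig 𝕋)} →
            (∀ x → x ∈var t → 𝕋 ⊢ σ x ≈ τ x) → 𝕋 ⊢ t ⟪ σ ⟫ ≈ t ⟪ τ ⟫
  ⟪⟫-cong (var x)  σ≈τ = σ≈τ x here
  ⟪⟫-cong (op o f) σ≈τ = cong o (λ i → ⟪⟫-cong (f i) (λ x x∈ → σ≈τ x (there i x∈)))

  ⟪⟫-identity : (t : TermOf 𝕋) → 𝕋 ⊢ t ⟪ var ⟫ ≈ t
  ⟪⟫-identity (var x)  = refl
  ⟪⟫-identity (op o f) = cong o (λ i → ⟪⟫-identity (f i))

  ≈-⟪⟫ : ∀ {a b : TermOf 𝕋} (τ : Subst (sig 𝕋)) → 𝕋 ⊢ a ≈ b → 𝕋 ⊢ a ⟪ τ ⟫ ≈ b ⟪ τ ⟫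
  ≈-⟪⟫ τ (ax a σ)       = trans (⟪⟫-assoc (lhs 𝕋 a) σ τ) (trans (ax a _) (sym (⟪⟫-assoc (rhs 𝕋 a) σ τ)))
  ≈-⟪⟫ τ refl           = refl
  ≈-⟪⟫ τ (sym a≈b)      = sym (≈-⟪⟫ τ a≈b)
  ≈-⟪⟫ τ (trans a≈b b≈c) = trans (≈-⟪⟫ τ a≈b) (≈-⟪⟫ τ b≈c)
  ≈-⟪⟫ τ (cong o f≈g)   = cong o (λ i → ≈-⟪⟫ τ (f≈g i))

  ⟪⟫-fixed : (t : TermOf 𝕋) {τ : Subst (sig 𝕋)} → (∀ x → x ∈var t → 𝕋 ⊢ τ x ≈ var x) → 𝕋 ⊢ t ⟪ τ ⟫ ≈ t
  ⟪⟫-fixed t τ≈var = trans (⟪⟫-cong t τ≈var) (⟪⟫-identity t)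

  closed-⟪⟫ : {E : TermOf 𝕋} → Closed E → (τ : Subst (sig 𝕋)) → 𝕋 ⊢ E ⟪ τ ⟫ ≈ E
  closed-⟪⟫ {E} E-closed τ = ⟪⟫-fixed E (λ x x∈ → ⊥-elim (E-closed x x∈))

  app2-cong : (w : TermOf 𝕋) {a a' b b' : TermOf 𝕋} →
              𝕋 ⊢ a ≈ a' → 𝕋 ⊢ b ≈ b' → 𝕋 ⊢ app2 w a b ≈ app2 w a' b'
  app2-cong w {a} {a'} {b} {b'} a≈a' b≈b' = ⟪⟫-cong w ab≈a'b'
    where
    ab≈a'b' : ∀ x → x ∈var w → 𝕋 ⊢ [ a , b ] x ≈ [ a' , b' ] x
    ab≈a'b' zero          _ = a≈a'
    ab≈a'b' (suc zero)    _ = b≈b'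
    ab≈a'b' (suc (suc x)) _ = refl

  binary-⟪⟫ : {w : TermOf 𝕋} → Binary w → (τ : Subst (sig 𝕋)) → 𝕋 ⊢ w ⟪ τ ⟫ ≈ app2 w (τ 0) (τ 1)
  binary-⟪⟫ {w} bw τ = ⟪⟫-cong w τ≈
    where
    τ≈ : ∀ x → x ∈var w → 𝕋 ⊢ τ x ≈ [ τ 0 , τ 1 ] x
    τ≈ x x∈ with bw x x∈
    ... | inj₁ P.refl = refl
    ... | inj₂ P.refl = refl

  app2-⟪⟫ : {w : TermOf 𝕋} → Binary w → (a b : TermOf 𝕋) (τ : Subst (sig 𝕋)) →
            𝕋 ⊢ app2 w a b ⟪ τ ⟫ ≈ app2 w (a ⟪ τ ⟫) (b ⟪ τ ⟫)
  app2-⟪⟫ {w} bw a b τ = trans (⟪⟫-assoc w [ a , b ] τ) (binary-⟪⟫ bw _)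

  app2-flip : {w : TermOf 𝕋} → Binary w → (a b : TermOf 𝕋) →
              𝕋 ⊢ app2 (app2 w (var 1) (var 0)) a b ≈ app2 w b a
  app2-flip bw a b = app2-⟪⟫ bw (var 1) (var 0) [ a , b ]

  app2-unitʳ : {w E : TermOf 𝕋} → Binary w → Closed E →
               𝕋 ⊢ app2 w (var 0) E ≈ var 0 → ∀ a → 𝕋 ⊢ app2 w a E ≈ a
  app2-unitʳ {w} {E} bw E-closed unit a =
    trans (app2-cong w refl (sym (closed-⟪⟫ E-closed (λ _ → a))))
          (trans (sym (app2-⟪⟫ bw (var 0) E (λ _ → a))) (≈-⟪⟫ (λ _ → a) unit))

  app2-unitˡ : {w E : TermOf 𝕋} → Binary w → Closed E →
               𝕋 ⊢ app2 w E (var 0) ≈ var 0 → ∀ a → 𝕋 ⊢ app2 w E a ≈ a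
  app2-unitˡ {w} {E} bw E-closed unit a =
    trans (app2-cong w (sym (closed-⟪⟫ E-closed (λ _ → a))) refl)
          (trans (sym (app2-⟪⟫ bw E (var 0) (λ _ → a))) (≈-⟪⟫ (λ _ → a) unit))

  module _ (CT : ClosedStable 𝕋) (VT : VarStable 𝕋) where

    ≈var⇒∈var : ∀ {u x} → 𝕋 ⊢ u ≈ var x → x ∈var u
    ≈var⇒∈var {u} {x} u≈x with hasVar? u
    ... | yes (y , y∈) = P.subst (_∈var u) (VT u x u≈x y y∈) y∈
    ... | no  none     = ⊥-elim (CT u (var x) (λ y y∈ → none (y , y∈)) u≈x x here)

    unitʳ⇒0∈var : ∀ {w E : TermOf 𝕋} → Closed E → 𝕋 ⊢ app2 w (var 0) E ≈ var 0 → 0 ∈var w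
    unitʳ⇒0∈var {w} {E} E-closed unit with ∈var-⟪⟫⁻ w [ var 0 , E ] (≈var⇒∈var unit)
    ... | zero          , x∈ , _   = x∈
    ... | suc zero      , _  , 0∈E = ⊥-elim (E-closed 0 0∈E)
    ... | suc (suc _)   , _  , ()

    unitˡ⇒1∈var : ∀ {w E : TermOf 𝕋} → Closed E → 𝕋 ⊢ app2 w E (var 0) ≈ var 0 → 1 ∈var w
    unitˡ⇒1∈var {w} {E} E-closed unit with ∈var-⟪⟫⁻ w [ E , var 0 ] (≈var⇒∈var unit)
    ... | zero          , _  , 0∈E = ⊥-elim (E-closed 0 0∈E)
    ... | suc zero      , x∈ , _   = x∈
    ... | suc (suc _)   , _  , ()

  -- Substituting the unit for q collapses app2 w (var p) (var q) to var p, which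
  -- by (T3) confines the variables of a that survive the substitution.
  ∈var-≈app2 : VarStable 𝕋 → {w E : TermOf 𝕋} → Binary w → Closed E → 𝕋 ⊢ app2 w (var 0) E ≈ var 0 →
               ∀ {a p q m} → p ≢ q → 𝕋 ⊢ a ≈ app2 w (var p) (var q) → m ∈var a → m ≡ p ⊎ m ≡ q
  ∈var-≈app2 VT {w} {E} bw E-closed unit {a} {p} {q} {m} p≢q a≈ m∈ with m ≟ q
  ... | yes m≡q = inj₂ m≡q
  ... | no  m≢q = inj₁ (VT (a ⟪ q ↦ E ⟫) p a[E/q]≈p m (∈var-⟪⟫ a _ m∈ m∈[E/q]m))
    where
    m∈[E/q]m : m ∈var (q ↦ E) m
    m∈[E/q]m = P.subst (m ∈var_) (P.sym (↦-other E m≢q)) here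
    a[E/q]≈p : 𝕋 ⊢ a ⟪ q ↦ E ⟫ ≈ var p
    a[E/q]≈p =
      trans (≈-⟪⟫ (q ↦ E) a≈)
      (trans (app2-⟪⟫ bw (var p) (var q) (q ↦ E))
      (trans (app2-cong w (≡⇒≈ (↦-other E p≢q)) (≡⇒≈ (↦-same q E)))
             (app2-unitʳ bw E-closed unit (var p))))

translate-⟪⟫ : ∀ {Sg} {𝕌 : Theory} (m : SigMor Sg (sig 𝕌)) (a : Term Sg) (σ : Subst Sg) →
               𝕌 ⊢ translate m (a ⟪ σ ⟫) ≈ translate m a ⟪ translate m ∘ σ ⟫
translate-⟪⟫ m (var x)  σ = refl
translate-⟪⟫ m (op o f) σ = cong (ι m o) (λ i → translate-⟪⟫ m (f _) σ)

module _ {𝕌 𝕋 : Theory} (c : Contains 𝕌 𝕋) where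

  tr-cong : ∀ {a b : TermOf 𝕋} → 𝕋 ⊢ a ≈ b → 𝕌 ⊢ tr c a ≈ tr c b
  tr-cong (ax a σ)        = trans (translate-⟪⟫ (incl c) (lhs 𝕋 a) σ)
                            (trans (≈-⟪⟫ _ (ax-provable c a)) (sym (translate-⟪⟫ (incl c) (rhs 𝕋 a) σ)))
  tr-cong refl            = refl
  tr-cong (sym a≈b)       = sym (tr-cong a≈b)
  tr-cong (trans a≈b b≈c) = trans (tr-cong a≈b) (tr-cong b≈c)
  tr-cong (cong o f≈g)    = cong (ι (incl c) o) (λ i → tr-cong (f≈g _))

  tr-closed : {E : TermOf 𝕋} → Closed E → Closed (tr c E)
  tr-closed {E} E-closed y y∈ = E-closed y (∈var-translate (incl c) E y∈)

  tr-binary : {w : TermOf 𝕋} → Binary w → Binary (tr c w)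
  tr-binary {w} bw y y∈ = bw y (∈var-translate (incl c) w y∈)

  tr-app2 : {w : TermOf 𝕋} → Binary w → (a b : TermOf 𝕋) →
            𝕌 ⊢ tr c (app2 w a b) ≈ app2 (tr c w) (tr c a) (tr c b)
  tr-app2 {w} bw a b = trans (translate-⟪⟫ (incl c) w [ a , b ]) (binary-⟪⟫ (tr-binary bw) _)

  tr-unitʳ : {w E : TermOf 𝕋} → Binary w → Closed E →
             𝕋 ⊢ app2 w (var 0) E ≈ var 0 → ∀ a → 𝕌 ⊢ app2 (tr c w) a (tr c E) ≈ a
  tr-unitʳ {w} {E} bw E-closed unit =
    app2-unitʳ (tr-binary bw) (tr-closed E-closed) (trans (sym (tr-app2 bw (var 0) E)) (tr-cong unit))

  tr-unitˡ : {w E : TermOf 𝕋} → Binary w → Closed E →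
             𝕋 ⊢ app2 w E (var 0) ≈ var 0 → ∀ a → 𝕌 ⊢ app2 (tr c w) (tr c E) a ≈ a
  tr-unitˡ {w} {E} bw E-closed unit =
    app2-unitˡ (tr-binary bw) (tr-closed E-closed) (trans (sym (tr-app2 bw E (var 0))) (tr-cong unit))

module Denotation {𝕌 𝕋 𝕊 : Theory} (cT : Contains 𝕌 𝕋) (cS : Contains 𝕌 𝕊) where

  ⟦_⟧ : Separated 𝕋 𝕊 → TermOf 𝕌
  ⟦ p ⟧ = ⟦ p ⟧sep cT cS

  ⟦⟧-cong-top : ∀ {T T' R} → 𝕋 ⊢ T ≈ T' → 𝕌 ⊢ ⟦ sep T R ⟧ ≈ ⟦ sep T' R ⟧
  ⟦⟧-cong-top T≈T' = ≈-⟪⟫ _ (tr-cong cT T≈T')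

  ⟦⟧-cong-bot : ∀ T {R R'} → (∀ x → x ∈var T → 𝕊 ⊢ R x ≈ R' x) → 𝕌 ⊢ ⟦ sep T R ⟧ ≈ ⟦ sep T R' ⟧
  ⟦⟧-cong-bot T R≈R' = ⟪⟫-cong (tr cT T) (λ x x∈ → tr-cong cS (R≈R' x (∈var-translate (incl cT) T x∈)))

  ⟦⟧-⟪⟫-top : ∀ T τ R → 𝕌 ⊢ ⟦ sep (T ⟪ τ ⟫) R ⟧ ≈ tr cT T ⟪ (λ z → ⟦ sep (τ z) R ⟧) ⟫
  ⟦⟧-⟪⟫-top T τ R = trans (≈-⟪⟫ _ (translate-⟪⟫ (incl cT) T τ)) (⟪⟫-assoc (tr cT T) _ _)

  ⟦⟧-⟪⟫-bot : ∀ T R τ → 𝕌 ⊢ ⟦ sep T (λ z → R z ⟪ τ ⟫) ⟧ ≈ ⟦ sep T R ⟧ ⟪ tr cS ∘ τ ⟫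
  ⟦⟧-⟪⟫-bot T R τ =
    trans (⟪⟫-cong (tr cT T) (λ z _ → translate-⟪⟫ (incl cS) (R z) τ)) (sym (⟪⟫-assoc (tr cT T) _ _))

  ⟦⟧-rename : ∀ f T R → 𝕌 ⊢ ⟦ sep (rename f T) R ⟧ ≈ ⟦ sep T (R ∘ f) ⟧
  ⟦⟧-rename f T R = ⟦⟧-⟪⟫-top T (var ∘ f) R

  ⟦⟧-binary : ∀ {T} → Binary T → (R : ℕ → TermOf 𝕊) →
              𝕌 ⊢ ⟦ sep T R ⟧ ≈ app2 (tr cT T) (tr cS (R 0)) (tr cS (R 1))
  ⟦⟧-binary bT R = binary-⟪⟫ (tr-binary cT bT) _

  -- A family of separated terms plugged into a 𝕋-term is again separated: the
  -- variable w of the z-th component is renamed apart to pair z w.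
  flatten : TermOf 𝕋 → (ℕ → Separated 𝕋 𝕊) → Separated 𝕋 𝕊
  flatten T P = sep (T ⟪ (λ z → rename (pair z) (top (P z))) ⟫) (uncurry (bot ∘ P) ∘ unpair)

  bot-flatten : ∀ T P z w → bot (flatten T P) (pair z w) ≡ bot (P z) w
  bot-flatten T P z w = P.cong (uncurry (bot ∘ P)) (unpair-pair z w)

  ∈var-flatten : ∀ {T P z w} → z ∈var T → w ∈var top (P z) → pair z w ∈var top (flatten T P)
  ∈var-flatten {T} {P} {z} z∈ w∈ = ∈var-⟪⟫ T _ z∈ (∈var-rename (pair z) (top (P z)) w∈)

  ⟦flatten⟧ : ∀ T P → 𝕌 ⊢ ⟦ flatten T P ⟧ ≈ tr cT T ⟪ ⟦_⟧ ∘ P ⟫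
  ⟦flatten⟧ T P =
    trans (⟦⟧-⟪⟫-top T _ _) (⟪⟫-cong (tr cT T) (λ z _ →
      trans (⟦⟧-rename (pair z) (top (P z)) _)
            (⟦⟧-cong-bot (top (P z)) (λ w _ → ≡⇒≈ (bot-flatten T P z w)))))

module CompositeProperties {𝕌 𝕋 𝕊 : Theory} {cT : Contains 𝕌 𝕋} {cS : Contains 𝕌 𝕊}
  (comp : Composite 𝕌 𝕋 𝕊 cT cS) (CT : ClosedStable 𝕋) (VT : VarStable 𝕋) where

  open Composite comp
  open Denotation cT cS

  sep≈𝕊⇒bot≈ : ∀ {T R c x} → 𝕌 ⊢ ⟦ sep T R ⟧ ≈ tr cS c → x ∈var T → 𝕊 ⊢ R x ≈ c
  sep≈𝕊⇒bot≈ {T} {R} {c} {x} sep≈c x∈ with uniqueness (sep T R) (sep (var 0) (λ _ → c)) (tr cS c) sep≈c refl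
  ... | g , g' , s̄ , T≈ , R≈ , c≈ =
    trans (R≈ x x∈) (trans (≡⇒≈ (P.cong s̄ (VT _ _ T≈ (g x) (∈var-rename g T x∈)))) (sym (c≈ 0 here)))

  𝕊≈sep⇒≈ : ∀ {a} T {c} → 𝕌 ⊢ tr cS a ≈ ⟦ sep T (λ _ → c) ⟧ → 𝕊 ⊢ a ≈ c
  𝕊≈sep⇒≈ {a} T {c} a≈sep with uniqueness (sep (var 0) (λ _ → a)) (sep T (λ _ → c)) (tr cS a) refl (sym a≈sep)
  ... | h , h' , s̄ , T≈ , a≈ , c≈ with ∈var-rename⁻ h' T (≈var⇒∈var CT VT (sym T≈))
  ... | w , w∈ , h0≡h'w = trans (a≈ 0 here) (trans (≡⇒≈ (P.cong s̄ h0≡h'w)) (sym (c≈ w w∈)))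

  -- Each bottom σ z⟪ρ⟫ is separated and the pieces flattened into one separated
  -- term equal to c; uniqueness then forces every new bottom to equal c.
  sep⟪⟫≈𝕊⇒bot≈ : ∀ {T σ ρ c z} → 𝕌 ⊢ ⟦ sep T σ ⟧ ⟪ ρ ⟫ ≈ tr cS c → z ∈var T →
                 (∀ x → x ∈var σ z → 𝕌 ⊢ ρ x ≈ var x) → 𝕊 ⊢ σ z ≈ c
  sep⟪⟫≈𝕊⇒bot≈ {T} {σ} {ρ} {c} {z} sep⟪ρ⟫≈c z∈ ρ-fixes = 𝕊≈sep⇒≈ (top (P z)) σz≈Pz
    where
    P : ℕ → Separated 𝕋 𝕊
    P y = proj₁ (separation (tr cS (σ y) ⟪ ρ ⟫))

    flatten≈c : 𝕌 ⊢ ⟦ flatten T P ⟧ ≈ tr cS c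
    flatten≈c =
      trans (⟦flatten⟧ T P)
      (trans (⟪⟫-cong (tr cT T) (λ y _ → sym (proj₂ (separation (tr cS (σ y) ⟪ ρ ⟫)))))
      (trans (sym (⟪⟫-assoc (tr cT T) _ ρ)) sep⟪ρ⟫≈c))

    σz≈Pz : 𝕌 ⊢ tr cS (σ z) ≈ ⟦ sep (top (P z)) (λ _ → c) ⟧
    σz≈Pz =
      trans (sym (⟪⟫-fixed (tr cS (σ z)) (λ x x∈ → ρ-fixes x (∈var-translate (incl cS) (σ z) x∈))))
      (trans (proj₂ (separation (tr cS (σ z) ⟪ ρ ⟫)))
             (⟦⟧-cong-bot (top (P z)) (λ w w∈ →
               trans (≡⇒≈ (P.sym (bot-flatten T P z w)))
                     (sep≈𝕊⇒bot≈ flatten≈c (∈var-flatten {T} {P} z∈ w∈)))))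

module Distributivity {𝕊 𝕋 𝕌 : Theory} {cT : Contains 𝕌 𝕋} {cS : Contains 𝕌 𝕊}
  (comp : Composite 𝕌 𝕋 𝕊 cT cS) (VS : VarStable 𝕊) (CT : ClosedStable 𝕋) (VT : VarStable 𝕋)
  (t : TermOf 𝕋) (bt : Binary t) {eₜ : TermOf 𝕋} (eₜ-closed : Closed eₜ)
  (t-unitʳ : 𝕋 ⊢ app2 t (var 0) eₜ ≈ var 0) (t-unitˡ : 𝕋 ⊢ app2 t eₜ (var 0) ≈ var 0)
  (s : TermOf 𝕊) (bs : Binary s) {eₛ : TermOf 𝕊} (eₛ-closed : Closed eₛ)
  (s-unitʳ : 𝕊 ⊢ app2 s (var 0) eₛ ≈ var 0) where

  open Composite comp
  open Denotation cT cS
  open CompositeProperties comp CT VT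
  open ≈-Reasoning 𝕌

  sU tU : TermOf 𝕌 → TermOf 𝕌 → TermOf 𝕌
  sU = app2 (tr cS s)
  tU = app2 (tr cT t)

  u : TermOf 𝕌
  u = sU (tU (var 1) (var 2)) (var 0)

  u-⟪⟫ : ∀ ρ → 𝕌 ⊢ u ⟪ ρ ⟫ ≈ sU (tU (ρ 1) (ρ 2)) (ρ 0)
  u-⟪⟫ ρ = trans (app2-⟪⟫ (tr-binary cS bs) _ _ ρ)
                 (app2-cong (tr cS s) (app2-⟪⟫ (tr-binary cT bt) (var 1) (var 2) ρ) refl)

  sU-as-tr : ∀ i → 𝕌 ⊢ sU (var i) (var 0) ≈ tr cS (app2 s (var i) (var 0))
  sU-as-tr i = sym (tr-app2 cS bs (var i) (var 0))

  u[eₛ/x₀] : 𝕌 ⊢ u ⟪ tr cS ∘ (0 ↦ eₛ) ⟫ ≈ tU (var 1) (var 2)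
  u[eₛ/x₀] = trans (u-⟪⟫ _) (tr-unitʳ cS bs eₛ-closed s-unitʳ _)

  u[eₜ/y₂] : 𝕌 ⊢ u ⟪ 2 ↦ tr cT eₜ ⟫ ≈ tr cS (app2 s (var 1) (var 0))
  u[eₜ/y₂] = trans (u-⟪⟫ _) (trans (app2-cong (tr cS s) (tr-unitʳ cT bt eₜ-closed t-unitʳ (var 1)) refl) (sU-as-tr 1))

  u[eₜ/y₁] : 𝕌 ⊢ u ⟪ 1 ↦ tr cT eₜ ⟫ ≈ tr cS (app2 s (var 2) (var 0))
  u[eₜ/y₁] = trans (u-⟪⟫ _) (trans (app2-cong (tr cS s) (tr-unitˡ cT bt eₜ-closed t-unitˡ (var 2)) refl) (sU-as-tr 2))

  module Separation (t' : TermOf 𝕋) (σ : ℕ → TermOf 𝕊) (u≈ : 𝕌 ⊢ u ≈ ⟦ sep t' σ ⟧) where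

    ⟦σ[eₛ/x₀]⟧≈ : 𝕌 ⊢ ⟦ sep t' (λ z → σ z ⟪ 0 ↦ eₛ ⟫) ⟧ ≈ tU (var 1) (var 2)
    ⟦σ[eₛ/x₀]⟧≈ = trans (⟦⟧-⟪⟫-bot t' σ (0 ↦ eₛ)) (trans (≈-⟪⟫ _ (sym u≈)) u[eₛ/x₀])

    ⟦t⟧≈ : 𝕌 ⊢ ⟦ sep t [ var 1 , var 2 ] ⟧ ≈ tU (var 1) (var 2)
    ⟦t⟧≈ = ⟦⟧-binary bt [ var 1 , var 2 ]

    -- If y_i is the only variable of σ z once x₀ is killed, then y_j does not occur
    -- in σ z, so killing y_j instead leaves σ z fixed and sep⟪⟫≈𝕊⇒bot≈ applies.
    bot≈s : ∀ {i j z} → i ≢ j → 0 ≢ j → 𝕌 ⊢ u ⟪ j ↦ tr cT eₜ ⟫ ≈ tr cS (app2 s (var i) (var 0)) →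
            z ∈var t' → 𝕊 ⊢ σ z ⟪ 0 ↦ eₛ ⟫ ≈ var i → 𝕊 ⊢ σ z ≈ app2 s (var i) (var 0)
    bot≈s {i} {j} {z} i≢j 0≢j u[eₜ/yⱼ] z∈ σz≈yᵢ =
      sep⟪⟫≈𝕊⇒bot≈ (trans (≈-⟪⟫ _ (sym u≈)) u[eₜ/yⱼ]) z∈ ρ-fixes
      where
      ρ-fixes : ∀ x → x ∈var σ z → 𝕌 ⊢ (j ↦ tr cT eₜ) x ≈ var x
      ρ-fixes x x∈ = ≡⇒≈ (↦-other _ x≢j)
        where
        x≢j : x ≢ j
        x≢j P.refl = i≢j (P.sym (VS _ i σz≈yᵢ x (∈var-⟪⟫ (σ z) _ x∈ x∈ε)))
          where
          x∈ε : x ∈var (0 ↦ eₛ) x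
          x∈ε = P.subst (x ∈var_) (P.sym (↦-other eₛ (0≢j ∘ P.sym))) here

    module Matching (f f' : ℕ → ℕ) (s̄ : ℕ → TermOf 𝕊) (t'≈t : 𝕋 ⊢ rename f t' ≈ rename f' t)
      (σ≈s̄ : ∀ z → z ∈var t' → 𝕊 ⊢ σ z ⟪ 0 ↦ eₛ ⟫ ≈ s̄ (f z))
      (y≈s̄ : ∀ x → x ∈var t → 𝕊 ⊢ [ var 1 , var 2 ] x ≈ s̄ (f' x)) where

      y₁≈s̄ : 𝕊 ⊢ var 1 ≈ s̄ (f' 0)
      y₁≈s̄ = y≈s̄ 0 (unitʳ⇒0∈var CT VT eₜ-closed t-unitʳ)

      y₂≈s̄ : 𝕊 ⊢ var 2 ≈ s̄ (f' 1)
      y₂≈s̄ = y≈s̄ 1 (unitˡ⇒1∈var CT VT eₜ-closed t-unitˡ)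

      f'0≢f'1 : f' 0 ≢ f' 1
      f'0≢f'1 eq with VS (var 1) 2 (trans y₁≈s̄ (trans (≡⇒≈ (P.cong s̄ eq)) (sym y₂≈s̄))) 1 here
      ... | ()

      f-binary : ∀ {z} → z ∈var t' → f z ≡ f' 0 ⊎ f z ≡ f' 1
      f-binary {z} z∈ =
        ∈var-≈app2 VT bt eₜ-closed t-unitʳ f'0≢f'1 (trans t'≈t (binary-⟪⟫ bt _)) (∈var-rename f t' z∈)

      σ≈-at : ∀ {i j k z} → i ≢ j → 0 ≢ j → 𝕌 ⊢ u ⟪ j ↦ tr cT eₜ ⟫ ≈ tr cS (app2 s (var i) (var 0)) →
              𝕊 ⊢ var i ≈ s̄ (f' k) → z ∈var t' → f z ≡ f' k → 𝕊 ⊢ σ z ≈ app2 s (s̄ (f z)) (var 0)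
      σ≈-at {i} {z = z} i≢j 0≢j u[eₜ/yⱼ] yᵢ≈s̄ z∈ fz≡ =
        trans (bot≈s i≢j 0≢j u[eₜ/yⱼ] z∈ (trans (σ≈s̄ _ z∈) s̄fz≈yᵢ)) (app2-cong s (sym s̄fz≈yᵢ) refl)
        where
        s̄fz≈yᵢ : 𝕊 ⊢ s̄ (f z) ≈ var i
        s̄fz≈yᵢ = trans (≡⇒≈ (P.cong s̄ fz≡)) (sym yᵢ≈s̄)

      σ≈ : ∀ z → z ∈var t' → 𝕊 ⊢ σ z ≈ app2 s (s̄ (f z)) (var 0)
      σ≈ z z∈ with f-binary z∈
      ... | inj₁ fz≡ = σ≈-at (λ ()) (λ ()) u[eₜ/y₂] y₁≈s̄ z∈ fz≡
      ... | inj₂ fz≡ = σ≈-at (λ ()) (λ ()) u[eₜ/y₁] y₂≈s̄ z∈ fz≡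

      distribʳ : 𝕌 ⊢ u ≈ tU (sU (var 1) (var 0)) (sU (var 2) (var 0))
      distribʳ = begin
        u                                                  ≈⟨ u≈ ⟩
        ⟦ sep t' σ ⟧                                       ≈⟨ ⟦⟧-cong-bot t' σ≈ ⟩
        ⟦ sep t' (V ∘ f) ⟧                                 ≈⟨ ⟦⟧-rename f t' V ⟨
        ⟦ sep (rename f t') V ⟧                            ≈⟨ ⟦⟧-cong-top t'≈t ⟩
        ⟦ sep (rename f' t) V ⟧                            ≈⟨ ⟦⟧-rename f' t V ⟩
        ⟦ sep t (V ∘ f') ⟧                                 ≈⟨ ⟦⟧-binary bt (V ∘ f') ⟩
        tU (tr cS (V (f' 0))) (tr cS (V (f' 1)))           ≈⟨ app2-cong (tr cT t) (V≈ y₁≈s̄) (V≈ y₂≈s̄) ⟩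
        tU (sU (var 1) (var 0)) (sU (var 2) (var 0))       ∎
        where
        V : ℕ → TermOf 𝕊
        V k = app2 s (s̄ k) (var 0)
        V≈ : ∀ {k i} → 𝕊 ⊢ var i ≈ s̄ k → 𝕌 ⊢ tr cS (V k) ≈ sU (var i) (var 0)
        V≈ {i = i} yᵢ≈ = trans (tr-cong cS (app2-cong s (sym yᵢ≈) refl)) (sym (sU-as-tr i))

    distribʳ : 𝕌 ⊢ u ≈ tU (sU (var 1) (var 0)) (sU (var 2) (var 0))
    distribʳ with uniqueness (sep t' (λ z → σ z ⟪ 0 ↦ eₛ ⟫)) (sep t [ var 1 , var 2 ]) _ ⟦σ[eₛ/x₀]⟧≈ ⟦t⟧≈
    ... | f , f' , s̄ , t'≈t , σ≈s̄ , y≈s̄ = Matching.distribʳ f f' s̄ t'≈t σ≈s̄ y≈s̄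

  distribʳ : 𝕌 ⊢ u ≈ tU (sU (var 1) (var 0)) (sU (var 2) (var 0))
  distribʳ with separation u
  ... | sep t' σ , u≈ = Separation.distribʳ t' σ u≈

theorem4p10 :
    (𝕊 𝕋 𝕌 : Theory) →
    ClosedStable 𝕊 → VarStable 𝕊 → CancelVars 𝕊 →
    ClosedStable 𝕋 → VarStable 𝕋 → HasConstant 𝕋 →
    (s : TermOf 𝕊) → Binary s → (t : TermOf 𝕋) → Binary t →
    (es : Op (sig 𝕊)) (es0 : ar (sig 𝕊) es ≡ 0) →
    (et : Op (sig 𝕋)) (et0 : ar (sig 𝕋) et ≡ 0) →
    𝕊 ⊢ app2 s (var 0) (constTerm es es0) ≈ var 0 →
    𝕊 ⊢ app2 s (constTerm es es0) (var 0) ≈ var 0 →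
    𝕋 ⊢ app2 t (var 0) (constTerm et et0) ≈ var 0 →
    𝕋 ⊢ app2 t (constTerm et et0) (var 0) ≈ var 0 →
    (cT : Contains 𝕌 𝕋) (cS : Contains 𝕌 𝕊) → Composite 𝕌 𝕋 𝕊 cT cS →
    -- x₀ = var 0, y₁ = var 1, y₂ = var 2
    (𝕌 ⊢ app2 (tr cS s) (app2 (tr cT t) (var 1) (var 2)) (var 0)
       ≈ app2 (tr cT t) (app2 (tr cS s) (var 1) (var 0)) (app2 (tr cS s) (var 2) (var 0)))
    ×
    (𝕌 ⊢ app2 (tr cS s) (var 0) (app2 (tr cT t) (var 1) (var 2))
       ≈ app2 (tr cT t) (app2 (tr cS s) (var 0) (var 1)) (app2 (tr cS s) (var 0) (var 2)))
theorem4p10 𝕊 𝕋 𝕌 _ VS _ CT VT _ s bs t bt es es0 et et0 s-unitʳ s-unitˡ t-unitʳ t-unitˡ cT cS comp =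
  D.distribʳ s bs eₛ-closed s-unitʳ ,
  (begin
    app2 (tr cS s) (var 0) y₁∙y₂                 ≈⟨ s⇄-flip y₁∙y₂ (var 0) ⟨
    app2 (tr cS s⇄) y₁∙y₂ (var 0)                ≈⟨ D.distribʳ s⇄ bs⇄ eₛ-closed s⇄-unitʳ ⟩
    app2 (tr cT t) (app2 (tr cS s⇄) (var 1) (var 0)) (app2 (tr cS s⇄) (var 2) (var 0))
                                                 ≈⟨ app2-cong (tr cT t) (s⇄-flip (var 1) (var 0)) (s⇄-flip (var 2) (var 0)) ⟩
    app2 (tr cT t) (app2 (tr cS s) (var 0) (var 1)) (app2 (tr cS s) (var 0) (var 2)) ∎)
  where
  open ≈-Reasoning 𝕌
  module D = Distributivity comp VS CT VT t bt (constTerm-closed et et0) t-unitʳ t-unitˡ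

  eₛ-closed : Closed (constTerm es es0)
  eₛ-closed = constTerm-closed es es0

  y₁∙y₂ : TermOf 𝕌
  y₁∙y₂ = app2 (tr cT t) (var 1) (var 2)

  s⇄ : TermOf 𝕊
  s⇄ = app2 s (var 1) (var 0)

  bs⇄ : Binary s⇄
  bs⇄ = app2-binary s (var 1) (var 0) bs (λ { _ here → inj₂ P.refl }) (λ { _ here → inj₁ P.refl })

  s⇄-unitʳ : 𝕊 ⊢ app2 s⇄ (var 0) (constTerm es es0) ≈ var 0
  s⇄-unitʳ = trans (app2-flip bs (var 0) _) s-unitˡ

  s⇄-flip : ∀ a b → 𝕌 ⊢ app2 (tr cS s⇄) a b ≈ app2 (tr cS s) b a
  s⇄-flip a b = trans (≈-⟪⟫ [ a , b ] (tr-app2 cS bs (var 1) (var 0))) (app2-flip (tr-binary cS bs) a b)
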